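{- Let $k\ge2$, $\sigma\in\{+,-\}^k$, $n\ge1$ and $\pi=\pi_1\cdots\pi_n\in\mathfrak S_n$ with $\pi_n=n$. Suppose $\hat\pi^*\in\mathcal C^{\sigma,*}$ and $\pi$ satisfies condition $(\dagger)$: there exists a $*$-$\sigma$-segmentation $0=e_0\le\cdots\le e_k=n$ of $\hat\pi^*$ such that there is no integer $b\ge1$ with $n-2b\ge1$ for which both $\rho(\pi_{n-2b},\pi_{n-b},\pi_n)\in\{312,132\}$ and, for all $1\le i\le b$ and $0\le t\le k-1$, $e_t<\pi_{n-b-i}\le e_{t+1}$ iff $e_t<\pi_{n-i}\le e_{t+1}$. Then $\pi\in\mathcal A_n(\Sigma_\sigma)$.
   Context: Fix $k\ge2$ and $\sigma=\sigma_0\cdots\sigma_{k-1}\in\{+,-\}^k$; $T^-_\sigma=\{t:\sigma_t=-\}$. $\mathcal W_k$ is the set of infinite words $s_1s_2\cdots$ over $\{0,\dots,k-1\}$. Order $\prec_\sigma$: for $s\ne t$, with $j$ minimal such that $s_j\ne t_j$ and $c=|\{1\le i<j:s_i\in T^-_\sigma\}|$, $s\prec_\sigma t$ iff ($c$ even and $s_j<t_j$) or ($c$ odd and $s_j>t_j$). $\Sigma_\sigma(s_1s_2\cdots)=s_2s_3\cdots$. $\rho(x_1,\dots,x_n)$ is the permutation of $[n]$ in the same relative order as the distinct $x_i$. $\mathrm{Pat}(s,\Sigma_\sigma,n)=\rho(s,\Sigma_\sigma(s),\dots,\Sigma_\sigma^{n-1}(s))$ (w.r.t. $\prec_\sigma$)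 when these $n$ words are distinct, undefined otherwise; $\mathcal A_n(\Sigma_\sigma)$ is the set of defined such patterns. For $\pi\in\mathfrak S_n$, $\hat\pi$ is given by $\hat\pi_{\pi_i}=\pi_{i+1}$ ($\pi_{n+1}:=\pi_1$), and $\hat\pi^*$ is the one-line word of $\hat\pi$ with the entry equal to $\pi_1$ replaced by $*$. $\mathcal C_n^*$: words obtained from an $n$-cycle (in one-line notation) by replacing one entry by $*$. A $*$-$\sigma$-segmentation of $\tau^*=\tau^*_1\cdots\tau^*_n$ is $0=e_0\le\cdots\le e_k=n$ with: (a) for each $t$, the non-$*$ entries of $\tau^*_{e_t+1}\cdots\tau^*_{e_{t+1}}$ are increasing if $\sigma_t=+$, decreasing if $\sigma_t=-$; (b) if $\sigma_0=+$ and $\tau^*_1\tau^*_2=*1$ then $e_1\le1$; (c) if $\sigma_{k-1}=+$ and $\tau^*_{n-1}\tau^*_n=n*$ then $e_{k-1}\ge n-1$; (d) if $\sigma_0=\sigma_{k-1}=-$, $\tau^*_1=n$ and $\tau^*_{n-1}\tau^*_n=1*$ then $e_1=0$ or $e_{k-1}\ge n-1$; (e) if $\sigma_0=\sigma_{k-1}=-$, $\tau^*_n=1$ and $\tau^*_1\tau^*_2=*n$ then $e_{k-1}=n$ or $e_1\le1$. $\mathcal C^{\sigma,*}$ is the set of elements of $\bigcup_n\mathcal C^*_n$ admitting one. -}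

module Defs where

open import Data.Nat using (ℕ; zero; suc; _+_; _*_; _∸_; _≤_; _<_; _≡ᵇ_)
open import Data.Fin using (Fin; toℕ)
open import Data.Bool using (if_then_else_)
open import Data.Maybe using (Maybe; just; nothing)
open import Data.Product using (Σ; ∃; _×_; _,_)
open import Data.Sum using (_⊎_)
open import Relation.Nullary using (¬_)
open import Relation.Binary.PropositionalEquality using (_≡_; _≢_)
open import Function.Bundles using (_⇔_)

data Sign : Set where
  plus minus : Sign

-- Infinite words over {0,…,k-1}: s : ℕ → Fin k, with s 0 = s₁, s 1 = s₂, …

Word : ℕ → Set
Word k = ℕ → Fin k

shift : ∀ {k} → Word k → Word k
shift s m = s (suc m)

shiftⁱ : ∀ {k} → ℕ → Word k → Word k
shiftⁱ i s m = s (i + m)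

countMinus : ∀ {k} → (Fin k → Sign) → Word k → ℕ → ℕ
countMinus σ s zero = zero
countMinus σ s (suc j) with σ (s j)
... | plus  = countMinus σ s j
... | minus = suc (countMinus σ s j)

data Even : ℕ → Set
data Odd  : ℕ → Set
data Even where
  ezero : Even zero
  esuc  : ∀ {n} → Odd n → Even (suc n)
data Odd where
  osuc  : ∀ {n} → Even n → Odd (suc n)

_≺[_]_ : ∀ {k} → Word k → (Fin k → Sign) → Word k → Set
s ≺[ σ ] t = ∃ λ j → (∀ i → i < j → s i ≡ t i) ×
  ((Even (countMinus σ s j) × toℕ (s j) < toℕ (t j)) ⊎
   (Odd  (countMinus σ s j) × toℕ (t j) < toℕ (s j)))

-- Permutations of [n] in one-line notation, 1-indexed: π : ℕ → ℕ,
-- only the values π 1, …, π n matter.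

IsPerm : ℕ → (ℕ → ℕ) → Set
IsPerm n π = (∀ i → 1 ≤ i → i ≤ n → 1 ≤ π i × π i ≤ n) ×
             (∀ i j → 1 ≤ i → i ≤ n → 1 ≤ j → j ≤ n → π i ≡ π j → i ≡ j)

-- π ∈ A_n(Σ_σ): some word s has Pat(s,Σ_σ,n) = π, i.e. the n words
-- s, Σ s, …, Σ^{n-1} s are in the same relative order as π₁,…,πₙ.
-- (Distinctness of the words follows since π is injective and ≺ is irreflexive.)
InA : (k : ℕ) → (Fin k → Sign) → (n : ℕ) → (ℕ → ℕ) → Set
InA k σ n π = ∃ λ (s : Word k) → ∀ i j → 1 ≤ i → i ≤ n → 1 ≤ j → j ≤ n →
  (π i < π j) ⇔ (shiftⁱ (i ∸ 1) s ≺[ σ ] shiftⁱ (j ∸ 1) s)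

-- π̂ and π̂*.  Words with a star: τ : ℕ → Maybe ℕ (nothing = *), 1-indexed.

findPos : (ℕ → ℕ) → ℕ → ℕ → ℕ
findPos π v zero = zero
findPos π v (suc m) = if π (suc m) ≡ᵇ v then suc m else findPos π v m

inv : ℕ → (ℕ → ℕ) → ℕ → ℕ
inv n π v = findPos π v n

-- π̂_{π_i} = π_{i+1}, with π_{n+1} := π_1
hat : ℕ → (ℕ → ℕ) → ℕ → ℕ
hat n π j = π (if inv n π j ≡ᵇ n then 1 else suc (inv n π j))

hatStar : ℕ → (ℕ → ℕ) → ℕ → Maybe ℕ
hatStar n π j = if hat n π j ≡ᵇ π 1 then nothing else just (hat n π j)

iter : (ℕ → ℕ) → ℕ → ℕ → ℕ
iter c zero x = x
iter c (suc m) x = c (iter c m x)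

IsNCycle : ℕ → (ℕ → ℕ) → Set
IsNCycle n c = IsPerm n c × (∀ m → 1 ≤ m → m < n → iter c m 1 ≢ 1)

InCStar : ℕ → (ℕ → Maybe ℕ) → Set
InCStar n τ = ∃ λ c → ∃ λ p → IsNCycle n c × 1 ≤ p × p ≤ n ×
  (∀ i → 1 ≤ i → i ≤ n → (i ≡ p → τ i ≡ nothing) × (i ≢ p → τ i ≡ just (c i)))

IsStarSeg : (k : ℕ) → (Fin k → Sign) → (n : ℕ) → (ℕ → Maybe ℕ) → (ℕ → ℕ) → Set
IsStarSeg k σ n τ e =
  e 0 ≡ 0 × e k ≡ n × (∀ t → t < k → e t ≤ e (suc t)) ×
  (∀ (t : Fin k) i j a b → e (toℕ t) < i → i < j → j ≤ e (suc (toℕ t)) →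
     τ i ≡ just a → τ j ≡ just b →
     (σ t ≡ plus → a < b) × (σ t ≡ minus → b < a)) ×
  (∀ (z : Fin k) → toℕ z ≡ 0 → σ z ≡ plus → 2 ≤ n →
     τ 1 ≡ nothing → τ 2 ≡ just 1 → e 1 ≤ 1) ×
  (∀ (l : Fin k) → suc (toℕ l) ≡ k → σ l ≡ plus → 2 ≤ n →
     τ (n ∸ 1) ≡ just n → τ n ≡ nothing → n ∸ 1 ≤ e (k ∸ 1)) ×
  (∀ (z l : Fin k) → toℕ z ≡ 0 → suc (toℕ l) ≡ k → σ z ≡ minus → σ l ≡ minus →
     2 ≤ n → τ 1 ≡ just n → τ (n ∸ 1) ≡ just 1 → τ n ≡ nothing →
     e 1 ≡ 0 ⊎ n ∸ 1 ≤ e (k ∸ 1)) ×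
  (∀ (z l : Fin k) → toℕ z ≡ 0 → suc (toℕ l) ≡ k → σ z ≡ minus → σ l ≡ minus →
     2 ≤ n → τ n ≡ just 1 → τ 1 ≡ nothing → τ 2 ≡ just n →
     e (k ∸ 1) ≡ n ⊎ e 1 ≤ 1)

InCσStar : (k : ℕ) → (Fin k → Sign) → (n : ℕ) → (ℕ → Maybe ℕ) → Set
InCσStar k σ n τ = InCStar n τ × ∃ λ e → IsStarSeg k σ n τ e

ρ-312-or-132 : ℕ → ℕ → ℕ → Set
ρ-312-or-132 x y z = (y < z × z < x) ⊎ (x < z × z < y)

Dagger : (k : ℕ) → (Fin k → Sign) → (n : ℕ) → (ℕ → ℕ) → Set
Dagger k σ n π = ∃ λ e → IsStarSeg k σ n (hatStar n π) e ×
  ¬ (∃ λ b → 1 ≤ b × 1 + 2 * b ≤ n ×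
       ρ-312-or-132 (π (n ∸ 2 * b)) (π (n ∸ b)) (π n) ×
       (∀ i t → 1 ≤ i → i ≤ b → t < k →
          ((e t < π (n ∸ b ∸ i) × π (n ∸ b ∸ i) ≤ e (suc t)) ⇔
           (e t < π (n ∸ i) × π (n ∸ i) ≤ e (suc t)))))

module Submission where

-- Let n = N + 1.  Since π n = n, the last of the n shifted words must be
-- the ≺_σ-largest one, so we take for it the ≺_σ-maximal word `maxWord`
-- (the largest letter wherever an even number of letters of sign − precede, the
-- smallest one otherwise), and put in front of it the letters ℓ(π 1) ⋯ ℓ(π N),
-- where ℓ v is the segment of the given *-σ-segmentation e of π̂* containing v.
--   * Two tails whose first letters differ compare like the segments of the values.
--   * Two tails starting in a common segment x compare like their own tails, in the
--     same (σ x = +) or opposite (σ x = −) direction; by condition (a) the map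
--     π̂ : π_i ↦ π_{i+1} does the same to the values, so induction applies.
--   * Every tail before position N differs from `maxWord`; this is where conditions
--     (a), (c) and (d) on the last values of π are used.

open import Defs
open import Data.Nat using (ℕ; _≤_)
open import Data.Fin using (Fin)
open import Relation.Binary.PropositionalEquality using (_≡_)
open import Data.Nat using (zero; suc; _+_; _∸_; _<_; _≡ᵇ_; z≤n; s≤s; s≤s⁻¹; _≤?_)
open import Data.Nat.Properties
open import Data.Fin using (toℕ; fromℕ) renaming (zero to fzero; suc to fsuc)
open import Data.Fin.Properties using (toℕ-injective; toℕ-fromℕ; toℕ<n) renaming (_≟_ to _≟ᶠ_)
open import Data.Bool using (Bool; true; false; not; T)
open import Data.Maybe using (Maybe; just; nothing)
open import Data.Product using (∃; _×_; _,_; proj₁; proj₂)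
open import Data.Sum using (_⊎_; inj₁; inj₂)
open import Data.Unit using (tt)
open import Data.Empty using (⊥; ⊥-elim)
open import Function using (case_of_)
open import Function.Bundles using (_⇔_; mk⇔)
open import Relation.Nullary using (yes; no)
open import Relation.Binary.PropositionalEquality
  using (_≢_; refl; sym; trans; cong; cong₂; subst; subst₂; module ≡-Reasoning)
open import Relation.Binary.Definitions using (tri<; tri≈; tri>)
open import Algebra.Properties.CommutativeSemigroup +-commutativeSemigroup using (x∙yz≈y∙xz)

even-odd-exclusive : ∀ {c} → Even c → Odd c → ⊥
even-odd-exclusive ezero ()
even-odd-exclusive (esuc o) (osuc e) = even-odd-exclusive e o

module WordOrder {k : ℕ} (σ : Fin k → Sign) where

  weight : Sign → ℕ
  weight plus  = 0
  weight minus = 1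

  countMinus-suc : (s : Word k) (j : ℕ) →
    countMinus σ s (suc j) ≡ weight (σ (s j)) + countMinus σ s j
  countMinus-suc s j with σ (s j)
  ... | plus  = refl
  ... | minus = refl

  countMinus-cong : (s t : Word k) (j : ℕ) → (∀ i → i < j → s i ≡ t i) →
    countMinus σ s j ≡ countMinus σ t j
  countMinus-cong s t zero    agree = refl
  countMinus-cong s t (suc j) agree = begin
      countMinus σ s (suc j)              ≡⟨ countMinus-suc s j ⟩
      weight (σ (s j)) + countMinus σ s j ≡⟨ cong₂ (λ x c → weight (σ x) + c) (agree j ≤-refl)
                                               (countMinus-cong s t j (λ i i<j → agree i (m<n⇒m<1+n i<j))) ⟩
      weight (σ (t j)) + countMinus σ t j ≡⟨ countMinus-suc t j ⟨
      countMinus σ t (suc j)              ∎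
    where open ≡-Reasoning

  countMinus-cons : (s : Word k) (j : ℕ) →
    countMinus σ s (suc j) ≡ weight (σ (s 0)) + countMinus σ (shift s) j
  countMinus-cons s zero    = countMinus-suc s 0
  countMinus-cons s (suc j) = begin
      countMinus σ s (suc (suc j))
        ≡⟨ countMinus-suc s (suc j) ⟩
      weight (σ (s (suc j))) + countMinus σ s (suc j)
        ≡⟨ cong (weight (σ (s (suc j))) +_) (countMinus-cons s j) ⟩
      weight (σ (s (suc j))) + (weight (σ (s 0)) + countMinus σ (shift s) j)
        ≡⟨ x∙yz≈y∙xz (weight (σ (s (suc j)))) (weight (σ (s 0))) _ ⟩
      weight (σ (s 0)) + (weight (σ (s (suc j))) + countMinus σ (shift s) j)
        ≡⟨ cong (weight (σ (s 0)) +_) (countMinus-suc (shift s) j) ⟨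
      weight (σ (s 0)) + countMinus σ (shift s) (suc j) ∎
    where open ≡-Reasoning

  Decides : ℕ → Fin k → Fin k → Set
  Decides c x y = (Even c × toℕ x < toℕ y) ⊎ (Odd c × toℕ y < toℕ x)

  decides-count : ∀ {c c' x y} → c ≡ c' → Decides c x y → Decides c' x y
  decides-count refl d = d

  decides-flip : ∀ {c x y} → Decides c x y → Decides (suc c) y x
  decides-flip (inj₁ (ev , lt)) = inj₂ (osuc ev , lt)
  decides-flip (inj₂ (od , lt)) = inj₁ (esuc od , lt)

  decides-distinct : ∀ {c x y} → Decides c x y → x ≢ y
  decides-distinct (inj₁ (_ , lt)) refl = <-irrefl refl lt
  decides-distinct (inj₂ (_ , lt)) refl = <-irrefl refl lt

  decides-asym : ∀ {c x y} → Decides c x y → Decides c y x → ⊥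
  decides-asym (inj₁ (_ , lt)) (inj₁ (_ , gt)) = <-asym lt gt
  decides-asym (inj₁ (ev , _)) (inj₂ (od , _)) = even-odd-exclusive ev od
  decides-asym (inj₂ (od , _)) (inj₁ (ev , _)) = even-odd-exclusive ev od
  decides-asym (inj₂ (_ , lt)) (inj₂ (_ , gt)) = <-asym lt gt

  _≺_ : Word k → Word k → Set
  s ≺ t = s ≺[ σ ] t

  ≺-resp : ∀ {u u' w w' : Word k} → (∀ m → u m ≡ u' m) → (∀ m → w m ≡ w' m) →
    u ≺ w → u' ≺ w'
  ≺-resp {u} {u'} eu ew (j , agree , d) =
    j , (λ i i<j → trans (sym (eu i)) (trans (agree i i<j) (ew i))) ,
    decides-count (countMinus-cong u u' j (λ i _ → eu i))
      (subst₂ (Decides (countMinus σ u j)) (eu j) (ew j) d)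

  ≺-asym : (s t : Word k) → s ≺ t → t ≺ s → ⊥
  ≺-asym s t (i , agree , d) (j , agree' , d') with <-cmp i j
  ... | tri< i<j _ _ = decides-distinct d (sym (agree' i i<j))
  ... | tri> _ _ j<i = decides-distinct d' (sym (agree j j<i))
  ... | tri≈ _ refl _ = decides-asym d (decides-count (sym (countMinus-cong s t i agree)) d')

  ≺-irrefl : (s : Word k) → s ≺ s → ⊥
  ≺-irrefl s p = ≺-asym s s p p

  ≺-head : (u w : Word k) → toℕ (u 0) < toℕ (w 0) → u ≺ w
  ≺-head u w lt = 0 , (λ _ ()) , inj₁ (ezero , lt)

  agree-cons : ∀ {u w : Word k} {j} → u 0 ≡ w 0 → (∀ i → i < j → u (suc i) ≡ w (suc i)) →
    ∀ i → i < suc j → u i ≡ w i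
  agree-cons eq₀ agree zero    _         = eq₀
  agree-cons eq₀ agree (suc i) (s≤s i<j) = agree i i<j

  ≺-cons-plus : (u w : Word k) → u 0 ≡ w 0 → σ (u 0) ≡ plus → shift u ≺ shift w → u ≺ w
  ≺-cons-plus u w eq₀ sx (j , agree , d) = suc j , agree-cons eq₀ agree , decides-count count d
    where
      count : countMinus σ (shift u) j ≡ countMinus σ u (suc j)
      count = sym (trans (countMinus-cons u j) (cong (λ sg → weight sg + countMinus σ (shift u) j) sx))

  ≺-cons-minus : (u w : Word k) → u 0 ≡ w 0 → σ (u 0) ≡ minus → shift w ≺ shift u → u ≺ w
  ≺-cons-minus u w eq₀ sx (j , agree , d) =
    suc j , agree-cons eq₀ (λ i i<j → sym (agree i i<j)) , decides-count (sym count) (decides-flip d)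
    where
      open ≡-Reasoning
      count : countMinus σ u (suc j) ≡ suc (countMinus σ (shift w) j)
      count = begin
        countMinus σ u (suc j)
          ≡⟨ countMinus-cons u j ⟩
        weight (σ (u 0)) + countMinus σ (shift u) j
          ≡⟨ cong (λ sg → weight sg + countMinus σ (shift u) j) sx ⟩
        suc (countMinus σ (shift u) j)
          ≡⟨ cong suc (countMinus-cong (shift u) (shift w) j (λ i i<j → sym (agree i i<j))) ⟩
        suc (countMinus σ (shift w) j) ∎

  firstDifference : (u v : Word k) (p : ℕ) → u p ≢ v p →
    ∃ λ j → (∀ i → i < j → u i ≡ v i) × u j ≢ v j
  firstDifference u v zero    ne = 0 , (λ _ ()) , ne
  firstDifference u v (suc p) ne with u 0 ≟ᶠ v 0
  ... | no ne₀  = 0 , (λ _ ()) , ne₀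
  ... | yes eq₀ with firstDifference (shift u) (shift v) p ne
  ...   | j , agree , neⱼ = suc j , agree-cons eq₀ agree , neⱼ

  Dominant : Word k → Set
  Dominant v = ∀ j (x : Fin k) → x ≢ v j → Decides (countMinus σ v j) x (v j)

  dominant-≺ : (u v : Word k) → Dominant v → (p : ℕ) → u p ≢ v p → u ≺ v
  dominant-≺ u v dom p ne with firstDifference u v p ne
  ... | j , agree , neⱼ = j , agree , decides-count (sym (countMinus-cong u v j agree)) (dom j (u j) neⱼ)

module MaximalWord {k' : ℕ} (σ : Fin (suc (suc k')) → Sign) where
  open WordOrder σ

  top bot : Fin (suc (suc k'))
  top = fromℕ (suc k')
  bot = fzero

  top≢bot : top ≢ bot
  top≢bot ()

  below-top : ∀ x → x ≢ top → toℕ x < toℕ top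
  below-top x ne = subst (toℕ x <_) (sym (toℕ-fromℕ (suc k')))
    (≤∧≢⇒< (s≤s⁻¹ (toℕ<n x)) (λ eq → ne (toℕ-injective (trans eq (sym (toℕ-fromℕ (suc k')))))))

  above-bot : ∀ x → x ≢ bot → toℕ bot < toℕ x
  above-bot fzero    ne = ⊥-elim (ne refl)
  above-bot (fsuc x) _  = s≤s z≤n

  letterOf : Bool → Fin (suc (suc k'))
  letterOf true  = top
  letterOf false = bot

  flipBy : Sign → Bool → Bool
  flipBy plus  b = b
  flipBy minus b = not b

  -- evenBefore j: whether an even number of letters of sign − precede position j
  -- in maxWord, which is top at such positions and bot elsewhere.
  evenBefore : ℕ → Bool
  evenBefore zero    = true
  evenBefore (suc j) = flipBy (σ (letterOf (evenBefore j))) (evenBefore j)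

  maxWord : Word (suc (suc k'))
  maxWord j = letterOf (evenBefore j)

  HasParity : Bool → ℕ → Set
  HasParity true  c = Even c
  HasParity false c = Odd c

  parity-step : ∀ sg b c → HasParity b c → HasParity (flipBy sg b) (weight sg + c)
  parity-step plus  b     c p  = p
  parity-step minus true  c ev = osuc ev
  parity-step minus false c od = esuc od

  evenBefore-correct : ∀ j → HasParity (evenBefore j) (countMinus σ maxWord j)
  evenBefore-correct zero    = ezero
  evenBefore-correct (suc j) = subst (HasParity (evenBefore (suc j))) (sym (countMinus-suc maxWord j))
    (parity-step (σ (maxWord j)) (evenBefore j) _ (evenBefore-correct j))

  maxWord-dominant : Dominant maxWord
  maxWord-dominant j x = dominate (evenBefore j) (evenBefore-correct j)
    where
      dominate : ∀ b → HasParity b (countMinus σ maxWord j) → x ≢ letterOf b →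
        Decides (countMinus σ maxWord j) x (letterOf b)
      dominate true  ev ne = inj₁ (ev , below-top x ne)
      dominate false od ne = inj₂ (od , above-bot x ne)

  evenBefore-plus : σ top ≡ plus → ∀ j → evenBefore j ≡ true
  evenBefore-plus st zero = refl
  evenBefore-plus st (suc j) rewrite evenBefore-plus st j | st = refl

  evenBefore-minus-plus : σ top ≡ minus → σ bot ≡ plus → ∀ j → evenBefore (suc j) ≡ false
  evenBefore-minus-plus st sb zero rewrite st = refl
  evenBefore-minus-plus st sb (suc j) rewrite evenBefore-minus-plus st sb j | sb = refl

  evenBefore-alternates : σ top ≡ minus → σ bot ≡ minus → ∀ j → evenBefore j ≡ not (evenBefore (suc j))
  evenBefore-alternates st sb j with evenBefore j
  ... | true  rewrite st = refl
  ... | false rewrite sb = refl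

prepend : ∀ {k} → ℕ → (ℕ → Fin k) → Word k → Word k
prepend zero    f w m       = w m
prepend (suc N) f w zero    = f zero
prepend (suc N) f w (suc m) = prepend N (λ i → f (suc i)) w m

prepend-prefix : ∀ {k} N (f : ℕ → Fin k) w m → m < N → prepend N f w m ≡ f m
prepend-prefix (suc N) f w zero    _         = refl
prepend-prefix (suc N) f w (suc m) (s≤s m<N) = prepend-prefix N (λ i → f (suc i)) w m m<N

prepend-suffix : ∀ {k} N (f : ℕ → Fin k) w m → prepend N f w (N + m) ≡ w m
prepend-suffix zero    f w m = refl
prepend-suffix (suc N) f w m = prepend-suffix N (λ i → f (suc i)) w m

-- The iterated shifts, defined so that tails s (a+1) is definitionally shift (tails s a).
tails : ∀ {k} → Word k → ℕ → Word k
tails s zero    = s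
tails s (suc a) = shift (tails s a)

tails-shiftⁱ : ∀ {k} (s : Word k) a m → tails s a m ≡ shiftⁱ a s m
tails-shiftⁱ s zero    m = refl
tails-shiftⁱ s (suc a) m = trans (tails-shiftⁱ s a (suc m)) (cong s (+-suc a m))

segment : (m : ℕ) → (ℕ → ℕ) → ℕ → Fin (suc m)
segment zero    f v = fzero
segment (suc m) f v with v ≤? f 1
... | yes _ = fzero
... | no _  = fsuc (segment m (λ t → f (suc t)) v)

segment-spec : ∀ m (f : ℕ → ℕ) v → f 0 < v → v ≤ f (suc m) →
  f (toℕ (segment m f v)) < v × v ≤ f (suc (toℕ (segment m f v)))
segment-spec zero    f v lo hi = lo , hi
segment-spec (suc m) f v lo hi with v ≤? f 1
... | yes v≤ = lo , v≤
... | no  v≰ = segment-spec m (λ t → f (suc t)) v (≰⇒> v≰) hi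

segment-mono : ∀ m (f : ℕ → ℕ) {v w} → v ≤ w → toℕ (segment m f v) ≤ toℕ (segment m f w)
segment-mono zero    f le = z≤n
segment-mono (suc m) f {v} {w} le with v ≤? f 1 | w ≤? f 1
... | yes _ | _     = z≤n
... | no v≰ | yes w≤ = ⊥-elim (v≰ (≤-trans le w≤))
... | no _  | no _  = s≤s (segment-mono m (λ t → f (suc t)) le)

≡ᵇ-refl : ∀ m → (m ≡ᵇ m) ≡ true
≡ᵇ-refl zero    = refl
≡ᵇ-refl (suc m) = ≡ᵇ-refl m

findPos-inverse : ∀ {n π} → IsPerm n π → ∀ m i → 1 ≤ i → i ≤ m → m ≤ n →
  findPos π (π i) m ≡ i
findPos-inverse perm zero i 1≤i i≤0 _ = ⊥-elim (<⇒≱ 1≤i (≤-trans i≤0 z≤n))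
findPos-inverse {π = π} perm (suc m) i 1≤i i≤m m≤n with π (suc m) ≡ᵇ π i in eq
... | true  = proj₂ perm (suc m) i (s≤s z≤n) m≤n 1≤i (≤-trans i≤m m≤n)
                (≡ᵇ⇒≡ _ _ (subst T (sym eq) tt))
... | false = findPos-inverse perm m i 1≤i i≤m' (≤-trans (n≤1+n m) m≤n)
  where
    i≤m' : i ≤ m
    i≤m' = s≤s⁻¹ (≤∧≢⇒< i≤m (λ i≡ → subst T eq (≡⇒≡ᵇ _ _ (cong π (sym i≡)))))

hat-at : ∀ {n π} → IsPerm n π → ∀ i → 1 ≤ i → i < n → hat n π (π i) ≡ π (suc i)
hat-at {n} {π} perm i 1≤i i<n rewrite findPos-inverse perm n i 1≤i (<⇒≤ i<n) ≤-refl with i ≡ᵇ n in eq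
... | true  = ⊥-elim (<⇒≢ i<n (≡ᵇ⇒≡ i n (subst T (sym eq) tt)))
... | false = refl

hatStar-at : ∀ {n π} → IsPerm n π → ∀ i → 1 ≤ i → i < n → hatStar n π (π i) ≡ just (π (suc i))
hatStar-at {n} {π} perm i 1≤i i<n rewrite hat-at perm i 1≤i i<n with π (suc i) ≡ᵇ π 1 in eq
... | true  = ⊥-elim (<⇒≢ (s≤s 1≤i) (sym (proj₂ perm (suc i) 1 (s≤s z≤n) i<n (s≤s z≤n)
                 (≤-trans 1≤i (<⇒≤ i<n)) (≡ᵇ⇒≡ _ _ (subst T (sym eq) tt)))))
... | false = refl

hatStar-max : ∀ {n π} → IsPerm n π → 1 ≤ n → π n ≡ n → hatStar n π n ≡ nothing
hatStar-max {n} {π} perm 1≤n πn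
  rewrite subst (λ v → findPos π v n ≡ n) πn (findPos-inverse perm n n 1≤n ≤-refl ≤-refl)
        | ≡ᵇ-refl n | ≡ᵇ-refl (π 1) = refl

starredCycle-entries : ∀ {n τ} → InCStar n τ → τ n ≡ nothing →
  ∀ j → 1 ≤ j → j < n → ∃ λ b → τ j ≡ just b × 1 ≤ b × b ≤ n
starredCycle-entries {n} (c , p , (c-perm , _) , 1≤p , p≤n , shape) τn j 1≤j j<n =
  c j , proj₂ (shape j 1≤j (<⇒≤ j<n)) (λ j≡p → <⇒≢ j<n (trans j≡p p≡n)) ,
  proj₁ c-perm j 1≤j (<⇒≤ j<n)
  where
    p≡n : p ≡ n
    p≡n with p ≟ n
    ... | yes eq = eq
    ... | no ne with trans (sym τn) (proj₂ (shape n (≤-trans 1≤p p≤n) ≤-refl) (λ n≡p → ne (sym n≡p)))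
    ...   | ()

module Construction
  (k' : ℕ) (σ : Fin (suc (suc k')) → Sign) (N : ℕ) (π : ℕ → ℕ)
  (perm : IsPerm (suc N) π) (π-last : π (suc N) ≡ suc N)
  (entry : ∀ j → 1 ≤ j → j < suc N → ∃ λ b → hatStar (suc N) π j ≡ just b × 1 ≤ b × b ≤ suc N)
  (e : ℕ → ℕ) (e-first : e 0 ≡ 0) (e-last : e (suc (suc k')) ≡ suc N)
  (condition-a : ∀ (t : Fin (suc (suc k'))) i j a b → e (toℕ t) < i → i < j → j ≤ e (suc (toℕ t)) →
     hatStar (suc N) π i ≡ just a → hatStar (suc N) π j ≡ just b →
     (σ t ≡ plus → a < b) × (σ t ≡ minus → b < a))
  (condition-c : ∀ (l : Fin (suc (suc k'))) → suc (toℕ l) ≡ suc (suc k') → σ l ≡ plus → 2 ≤ suc N →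
     hatStar (suc N) π N ≡ just (suc N) → hatStar (suc N) π (suc N) ≡ nothing → N ≤ e (suc k'))
  (condition-d : ∀ (z l : Fin (suc (suc k'))) → toℕ z ≡ 0 → suc (toℕ l) ≡ suc (suc k') →
     σ z ≡ minus → σ l ≡ minus → 2 ≤ suc N → hatStar (suc N) π 1 ≡ just (suc N) →
     hatStar (suc N) π N ≡ just 1 → hatStar (suc N) π (suc N) ≡ nothing → e 1 ≡ 0 ⊎ N ≤ e (suc k'))
  where

  open WordOrder σ
  open MaximalWord σ

  K n : ℕ
  K = suc (suc k')
  n = suc N

  τ : ℕ → Maybe ℕ
  τ = hatStar n π

  π-range : ∀ a → a ≤ N → 1 ≤ π (suc a) × π (suc a) ≤ n
  π-range a a≤N = proj₁ perm (suc a) (s≤s z≤n) (s≤s a≤N)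

  -- Positions before n carry values in [1,N], as the value n sits at position n.
  π-below : ∀ i → 1 ≤ i → i ≤ N → 1 ≤ π i × π i ≤ N
  π-below i 1≤i i≤N = proj₁ range , s≤s⁻¹ (≤∧≢⇒< (proj₂ range) πi≢n)
    where
      range : 1 ≤ π i × π i ≤ n
      range = proj₁ perm i 1≤i (m≤n⇒m≤1+n i≤N)
      πi≢n : π i ≢ n
      πi≢n eq = <⇒≢ (s≤s i≤N)
        (proj₂ perm i n 1≤i (m≤n⇒m≤1+n i≤N) (s≤s z≤n) ≤-refl (trans eq (sym π-last)))

  τ-step : ∀ a → a < N → τ (π (suc a)) ≡ just (π (suc (suc a)))
  τ-step a a<N = hatStar-at perm (suc a) (s≤s z≤n) (s≤s a<N)

  τ-before-last : 1 ≤ N → τ (π N) ≡ just n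
  τ-before-last 1≤N = trans (hatStar-at perm N 1≤N ≤-refl) (cong just π-last)

  τ-last : τ n ≡ nothing
  τ-last = hatStar-max perm (s≤s z≤n) π-last

  InSegment : Fin K → ℕ → Set
  InSegment t v = e (toℕ t) < v × v ≤ e (suc (toℕ t))

  ℓ : ℕ → Fin K
  ℓ = segment (suc k') e

  ℓ-spec : ∀ v → 1 ≤ v → v ≤ n → InSegment (ℓ v) v
  ℓ-spec v 1≤v v≤n =
    segment-spec (suc k') e v (subst (_< v) (sym e-first) 1≤v) (subst (v ≤_) (sym e-last) v≤n)

  ℓ-spec-at : ∀ {t} v → 1 ≤ v → v ≤ n → ℓ v ≡ t → InSegment t v
  ℓ-spec-at v 1≤v v≤n refl = ℓ-spec v 1≤v v≤n

  segment-positive : ∀ {t v} → InSegment t v → 1 ≤ v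
  segment-positive (lo , _) = ≤-trans (s≤s z≤n) lo

  in-top : ∀ {v} → InSegment top v → e (suc k') < v
  in-top {v} (lo , _) = subst (λ x → e x < v) (toℕ-fromℕ (suc k')) lo

  top-contains : ∀ {v} → e (suc k') < v → v ≤ n → InSegment top v
  top-contains {v} lo hi = subst (λ x → e x < v × v ≤ e (suc x)) (sym (toℕ-fromℕ (suc k')))
    (lo , subst (v ≤_) (sym e-last) hi)

  bot-contains : ∀ {v} → 1 ≤ v → v ≤ e 1 → InSegment bot v
  bot-contains {v} 1≤v hi = subst (_< v) (sym e-first) 1≤v , hi

  ordered : ∀ t {x y a b} → InSegment t x → InSegment t y → x < y → τ x ≡ just a → τ y ≡ just b →
    (σ t ≡ plus → a < b) × (σ t ≡ minus → b < a)
  ordered t (lo , _) (_ , hi) x<y = condition-a t _ _ _ _ lo x<y hi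

  max-last-in-plus : ∀ t {x y} → σ t ≡ plus → InSegment t x → InSegment t y → x < y → y < n →
    τ x ≡ just n → ⊥
  max-last-in-plus t sg inx iny x<y y<n τx with entry _ (segment-positive iny) y<n
  ... | b , τy , _ , b≤n = <⇒≱ (proj₁ (ordered t inx iny x<y τx τy) sg) b≤n

  max-first-in-minus : ∀ t {x y} → σ t ≡ minus → InSegment t x → InSegment t y → x < y → y ≤ n →
    τ y ≡ just n → ⊥
  max-first-in-minus t sg inx iny x<y y≤n τy with entry _ (segment-positive inx) (<-≤-trans x<y y≤n)
  ... | b , τx , _ , b≤n = <⇒≱ (proj₂ (ordered t inx iny x<y τx τy) sg) b≤n

  min-last-in-minus : ∀ t {x y} → σ t ≡ minus → InSegment t x → InSegment t y → x < y → y < n →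
    τ x ≡ just 1 → ⊥
  min-last-in-minus t sg inx iny x<y y<n τx with entry _ (segment-positive iny) y<n
  ... | b , τy , 1≤b , _ = <⇒≱ (proj₂ (ordered t inx iny x<y τx τy) sg) 1≤b

  -- By (a) and (c): if σ top = +, then π N is not in the top segment.  Otherwise π̂* has
  -- the entry n at π N, which is either before position N or, if π N = N, excluded by (c).
  last-notTop : σ top ≡ plus → 1 ≤ N → ℓ (π N) ≢ top
  last-notTop st 1≤N ℓ≡top = case m≤n⇒m<n∨m≡n (proj₂ v-range) of λ where
      (inj₁ v<N) → max-last-in-plus top st v-top (top-contains (<-trans (in-top v-top) v<N) (n≤1+n N))
                     v<N ≤-refl (τ-before-last 1≤N)
      (inj₂ v≡N) → <⇒≱ (subst (e (suc k') <_) v≡N (in-top v-top))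
                     (condition-c top (cong suc (toℕ-fromℕ (suc k'))) st (s≤s 1≤N)
                       (subst (λ x → τ x ≡ just n) v≡N (τ-before-last 1≤N)) τ-last)
    where
      v-range : 1 ≤ π N × π N ≤ N
      v-range = π-below N 1≤N ≤-refl
      v-top : InSegment top (π N)
      v-top = ℓ-spec-at (π N) (proj₁ v-range) (m≤n⇒m≤1+n (proj₂ v-range)) ℓ≡top

  -- By (a) and (d): if σ top = σ bot = −, then π N in the bottom segment and π (N−1)
  -- in the top segment is impossible.  Indeed (a) forces π N = 1 and π (N−1) = N, so
  -- π̂* starts with n and ends with 1 *, which (d) forbids for such a segmentation.
  lastTwo-notBotTop : σ top ≡ minus → σ bot ≡ minus → ∀ m → suc (suc m) ≡ N →
    ℓ (π N) ≡ bot → ℓ (π (suc m)) ≢ top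
  lastTwo-notBotTop st sb m m+2≡N ℓv≡bot ℓu≡top =
    case condition-d bot top refl (cong suc (toℕ-fromℕ (suc k'))) sb st (s≤s 1≤N) τ1 τN τ-last of λ where
      (inj₁ e₁≡0) → <⇒≱ (proj₁ v-range) (subst (π N ≤_) e₁≡0 (proj₂ v-bot))
      (inj₂ N≤e) → <⇒≱ (subst (e (suc k') <_) u≡N (in-top u-top)) N≤e
    where
      1≤N : 1 ≤ N
      1≤N = subst (1 ≤_) m+2≡N (s≤s z≤n)
      sm≤N : suc m ≤ N
      sm≤N = subst (suc m ≤_) m+2≡N (n≤1+n (suc m))
      v-range : 1 ≤ π N × π N ≤ N
      v-range = π-below N 1≤N ≤-refl
      u-range : 1 ≤ π (suc m) × π (suc m) ≤ N
      u-range = π-below (suc m) (s≤s z≤n) sm≤N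
      v-bot : InSegment bot (π N)
      v-bot = ℓ-spec-at (π N) (proj₁ v-range) (m≤n⇒m≤1+n (proj₂ v-range)) ℓv≡bot
      u-top : InSegment top (π (suc m))
      u-top = ℓ-spec-at (π (suc m)) (proj₁ u-range) (m≤n⇒m≤1+n (proj₂ u-range)) ℓu≡top
      τu : τ (π (suc m)) ≡ just (π N)
      τu = trans (τ-step m sm≤N) (cong (λ x → just (π x)) m+2≡N)
      v≡1 : π N ≡ 1
      v≡1 = case m≤n⇒m<n∨m≡n (proj₁ v-range) of λ where
        (inj₁ 1<v) → ⊥-elim (max-first-in-minus bot sb
                       (bot-contains ≤-refl (≤-trans (<⇒≤ 1<v) (proj₂ v-bot))) v-bot 1<v
                       (m≤n⇒m≤1+n (proj₂ v-range)) (τ-before-last 1≤N))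
        (inj₂ 1≡v) → sym 1≡v
      u≡N : π (suc m) ≡ N
      u≡N = case m≤n⇒m<n∨m≡n (proj₂ u-range) of λ where
        (inj₁ u<N) → ⊥-elim (min-last-in-minus top st u-top
                       (top-contains (<-trans (in-top u-top) u<N) (n≤1+n N)) u<N ≤-refl
                       (trans τu (cong just v≡1)))
        (inj₂ u≡N) → u≡N
      τ1 : τ 1 ≡ just n
      τ1 = subst (λ x → τ x ≡ just n) v≡1 (τ-before-last 1≤N)
      τN : τ N ≡ just 1
      τN = subst (λ x → τ x ≡ just 1) u≡N (trans τu (cong just v≡1))

  s : Word K
  s = prepend N (λ x → ℓ (π (suc x))) maxWord

  tail : ℕ → Word K
  tail = tails s

  tail-prefix : ∀ a m → suc (a + m) ≤ N → tail a m ≡ ℓ (π (suc (a + m)))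
  tail-prefix a m lt = trans (tails-shiftⁱ s a m) (prepend-prefix N _ maxWord (a + m) lt)

  tail-head : ∀ a → a < N → tail a 0 ≡ ℓ (π (suc a))
  tail-head a a<N = trans (tail-prefix a 0 (subst (λ x → suc x ≤ N) (sym (+-identityʳ a)) a<N))
                          (cong (λ x → ℓ (π (suc x))) (+-identityʳ a))

  tail-max : ∀ m → tail N m ≡ maxWord m
  tail-max m = trans (tails-shiftⁱ s N m) (prepend-suffix N _ maxWord m)

  tail-last : ∀ a d → a + suc d ≡ N → tail a d ≡ ℓ (π N)
  tail-last a d eq = trans (tail-prefix a d (≤-reflexive eq')) (cong (λ x → ℓ (π x)) eq')
    where
      eq' : suc (a + d) ≡ N
      eq' = trans (sym (+-suc a d)) eq

  tail-top : ∀ a d → a + suc d ≡ N → tail a (suc d) ≡ top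
  tail-top a d eq = begin
      tail a (suc d) ≡⟨ tails-shiftⁱ s a (suc d) ⟩
      s (a + suc d)  ≡⟨ cong s (trans eq (sym (+-identityʳ N))) ⟩
      s (N + 0)      ≡⟨ prepend-suffix N _ maxWord 0 ⟩
      maxWord 0      ∎
    where open ≡-Reasoning

  -- When σ top = σ bot = − and maxWord d = bot: compare at d, or else at d − 1,
  -- where maxWord is top but tail a is not (lastTwo-notBotTop).
  differs-before-bot : σ top ≡ minus → σ bot ≡ minus → ∀ a d → a + suc d ≡ N →
    evenBefore d ≡ false → ∃ λ p → tail a p ≢ maxWord p
  differs-before-bot st sb a zero    eq ()
  differs-before-bot st sb a (suc d) eq ed with ℓ (π N) ≟ᶠ bot
  ... | no ℓ≢bot = suc d , λ same →
          ℓ≢bot (trans (sym (tail-last a (suc d) eq)) (trans same (cong letterOf ed)))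
  ... | yes ℓ≡bot = d , λ same → lastTwo-notBotTop st sb (a + d) eq' ℓ≡bot
          (trans (sym (tail-prefix a d (subst (suc (a + d) ≤_) eq' (n≤1+n _))))
            (trans same (cong letterOf (trans (evenBefore-alternates st sb d) (cong not ed)))))
    where
      eq' : suc (suc (a + d)) ≡ N
      eq' = trans (cong suc (sym (+-suc a d))) (trans (sym (+-suc a (suc d))) eq)

  tail-differs : ∀ a → a < N → ∃ λ p → tail a p ≢ maxWord p
  tail-differs a a<N with m≤n⇒∃[o]m+o≡n a<N
  ... | d , eq = bySign (σ top) (σ bot) refl refl
    where
      eq' : a + suc d ≡ N
      eq' = trans (+-suc a d) eq
      at-top : tail a (suc d) ≡ top
      at-top = tail-top a d eq'
      bySign : ∀ sgTop sgBot → σ top ≡ sgTop → σ bot ≡ sgBot → ∃ λ p → tail a p ≢ maxWord p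
      bySign plus _ st _ = d , λ same → last-notTop st (≤-trans (s≤s z≤n) a<N)
        (trans (sym (tail-last a d eq')) (trans same (cong letterOf (evenBefore-plus st d))))
      bySign minus plus st sb = suc d , λ same →
        top≢bot (trans (sym at-top) (trans same (cong letterOf (evenBefore-minus-plus st sb d))))
      bySign minus minus st sb with evenBefore (suc d) in ed
      ... | false = suc d , λ same → top≢bot (trans (sym at-top) (trans same (cong letterOf ed)))
      ... | true  = differs-before-bot st sb a d eq' (trans (evenBefore-alternates st sb d) (cong not ed))

  tail-below-max : ∀ a → a < N → tail a ≺ tail N
  tail-below-max a a<N with tail-differs a a<N
  ... | p , ne = ≺-resp (λ _ → refl) (λ m → sym (tail-max m))
                   (dominant-≺ (tail a) maxWord maxWord-dominant p ne)

  -- Tails a, b < N starting in a common segment x: by (a), π_{a+2}, π_{b+2} are ordered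
  -- like π_{a+1}, π_{b+1} if σ x = + and oppositely if σ x = −, and so are the tails.
  same-segment : ∀ a b → a < N → b < N → π (suc a) < π (suc b) → ℓ (π (suc a)) ≡ ℓ (π (suc b)) →
    (π (suc (suc a)) < π (suc (suc b)) → tail (suc a) ≺ tail (suc b)) →
    (π (suc (suc b)) < π (suc (suc a)) → tail (suc b) ≺ tail (suc a)) →
    tail a ≺ tail b
  same-segment a b a<N b<N lt ℓ≡ forward backward = bySign (σ x) refl
    where
      x : Fin K
      x = ℓ (π (suc a))
      heads : tail a 0 ≡ tail b 0
      heads = trans (tail-head a a<N) (trans ℓ≡ (sym (tail-head b b<N)))
      sign-head : σ (tail a 0) ≡ σ x
      sign-head = cong σ (tail-head a a<N)
      range-a : 1 ≤ π (suc a) × π (suc a) ≤ n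
      range-a = π-range a (<⇒≤ a<N)
      range-b : 1 ≤ π (suc b) × π (suc b) ≤ n
      range-b = π-range b (<⇒≤ b<N)
      monotone : (σ x ≡ plus → π (suc (suc a)) < π (suc (suc b))) ×
                 (σ x ≡ minus → π (suc (suc b)) < π (suc (suc a)))
      monotone = ordered x (ℓ-spec _ (proj₁ range-a) (proj₂ range-a))
                   (ℓ-spec-at _ (proj₁ range-b) (proj₂ range-b) (sym ℓ≡))
                   lt (τ-step a a<N) (τ-step b b<N)
      bySign : ∀ sg → σ x ≡ sg → tail a ≺ tail b
      bySign plus  sx = ≺-cons-plus (tail a) (tail b) heads (trans sign-head sx) (forward (proj₁ monotone sx))
      bySign minus sx = ≺-cons-minus (tail a) (tail b) heads (trans sign-head sx) (backward (proj₂ monotone sx))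

  tail-compare : ∀ r a b → N ≤ a + r → N ≤ b + r → a ≤ N → b ≤ N → π (suc a) < π (suc b) →
    tail a ≺ tail b

  tail-compare-interior : ∀ r a b → N ≤ a + r → N ≤ b + r → a < N → b < N → π (suc a) < π (suc b) →
    tail a ≺ tail b
  tail-compare-interior zero a b fa _ a<N _ _ = ⊥-elim (<⇒≱ a<N (subst (N ≤_) (+-identityʳ a) fa))
  tail-compare-interior (suc r) a b fa fb a<N b<N lt with m≤n⇒m<n∨m≡n (segment-mono (suc k') e (<⇒≤ lt))
  ... | inj₁ ℓ< = ≺-head (tail a) (tail b)
                    (subst₂ (λ x y → toℕ x < toℕ y) (sym (tail-head a a<N)) (sym (tail-head b b<N)) ℓ<)
  ... | inj₂ ℓ≡ = same-segment a b a<N b<N lt (toℕ-injective ℓ≡)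
                    (tail-compare r (suc a) (suc b) fa' fb' a<N b<N)
                    (tail-compare r (suc b) (suc a) fb' fa' b<N a<N)
    where
      fa' : N ≤ suc a + r
      fa' = subst (N ≤_) (+-suc a r) fa
      fb' : N ≤ suc b + r
      fb' = subst (N ≤_) (+-suc b r) fb

  tail-compare r a b fa fb a≤N b≤N lt with m≤n⇒m<n∨m≡n a≤N | m≤n⇒m<n∨m≡n b≤N
  ... | inj₂ refl | _ = ⊥-elim (<⇒≱ lt (subst (π (suc b) ≤_) (sym π-last) (proj₂ (π-range b b≤N))))
  ... | inj₁ a<N | inj₂ refl = tail-below-max a a<N
  ... | inj₁ a<N | inj₁ b<N = tail-compare-interior r a b fa fb a<N b<N lt

  realises : InA K σ n π
  realises = s , ordered-like-π
    where
      compare : ∀ a b → a ≤ N → b ≤ N → π (suc a) < π (suc b) → shiftⁱ a s ≺ shiftⁱ b s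
      compare a b a≤N b≤N lt = ≺-resp (tails-shiftⁱ s a) (tails-shiftⁱ s b)
        (tail-compare N a b (m≤n+m N a) (m≤n+m N b) a≤N b≤N lt)
      ordered-like-π : ∀ i j → 1 ≤ i → i ≤ n → 1 ≤ j → j ≤ n →
        (π i < π j) ⇔ (shiftⁱ (i ∸ 1) s ≺ shiftⁱ (j ∸ 1) s)
      ordered-like-π (suc a) (suc b) _ i≤n _ j≤n = mk⇔ (compare a b a≤N b≤N) reflect
        where
          a≤N : a ≤ N
          a≤N = s≤s⁻¹ i≤n
          b≤N : b ≤ N
          b≤N = s≤s⁻¹ j≤n
          reflect : shiftⁱ a s ≺ shiftⁱ b s → π (suc a) < π (suc b)
          reflect a≺b with <-cmp (π (suc a)) (π (suc b))
          ... | tri< lt _ _ = lt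
          ... | tri≈ _ eq _ = ⊥-elim (≺-irrefl (shiftⁱ b s) (subst (λ x → shiftⁱ x s ≺ shiftⁱ b s) a≡b a≺b))
            where
              a≡b : a ≡ b
              a≡b = suc-injective (proj₂ perm _ _ (s≤s z≤n) i≤n (s≤s z≤n) j≤n eq)
          ... | tri> _ _ gt = ⊥-elim (≺-asym (shiftⁱ a s) (shiftⁱ b s) a≺b (compare b a b≤N a≤N gt))

lemma2p5 : (k : ℕ) → 2 ≤ k → (σ : Fin k → Sign) → (n : ℕ) → 1 ≤ n →
    (π : ℕ → ℕ) → IsPerm n π → π n ≡ n →
    InCσStar k σ n (hatStar n π) → Dagger k σ n π → InA k σ n π
lemma2p5 (suc (suc k')) (s≤s (s≤s z≤n)) σ (suc N) (s≤s z≤n) π perm π-last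
         (cstar , e , e-first , e-last , _ , condition-a , _ , condition-c , condition-d , _) _ =
  Construction.realises k' σ N π perm π-last entries e e-first e-last condition-a condition-c condition-d
  where
    entries : ∀ j → 1 ≤ j → j < suc N → ∃ λ b → hatStar (suc N) π j ≡ just b × 1 ≤ b × b ≤ suc N
    entries = starredCycle-entries cstar (hatStar-max perm (s≤s z≤n) π-last)
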